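{- Let $m,n\ge 1$ be integers and let $H^f[m,n]$ be the hexagonal lattice network with free boundary condition (defined in the context). Then for all real numbers $a,b$, \[ Z_{a,b}(H^f[m,n])=(3mn-2m-2n+1)\cdot 2\cdot 3^{a+b}+2^{a+b+2}+(4m+4n-4)(3^a2^b+3^b2^a)+2(3^a+3^b). \]
   Context: For a simple graph $G$ with vertex degrees $d(v)$ and real numbers $a,b$, the general Zagreb index (or $(a,b)$-Zagreb index) is $Z_{a,b}(G)=\sum_{uv\in E(G)}\big(d(u)^a d(v)^b+d(u)^b d(v)^a\big)$. The hexagonal lattice network with free boundary condition $H^f[m,n]$ ($m,n\ge1$) is the graph with vertex set $\{x_{i,j}:1\le i\le m+1,\ 1\le j\le 2n+2\}$ and edges $x_{i,j}x_{i,j+1}$ for $1\le i\le m+1$, $1\le j\le 2n+1$ (so each row is a path on $2n+2$ vertices), together with the edges $x_{i,2k}x_{i+1,2k-1}$ for $1\le i\le m$, $1\le k\le n+1$. (It consists of $m$ rows of $n$ hexagons, with $x_{1,1}$ and $x_{m+1,2n+2}$ pendant vertices; it has $2(m+1)(n+1)$ vertices and $m(n+1)+(m+1)(2n+1)$ edges.) -}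

module Defs where

open import Level using (Level)
open import Data.Nat using (ℕ; zero; suc; _∸_; _≟_) renaming (_+_ to _+ℕ_; _*_ to _*ℕ_)
open import Data.List using (List; []; _∷_; _++_; map; concatMap; length; filter; upTo; foldr)
open import Data.Product using (_×_; _,_; proj₁; proj₂)
open import Data.Product.Properties using (≡-dec)
open import Relation.Nullary.Decidable using (_⊎-dec_)
open import Relation.Binary.PropositionalEquality using (_≡_)
open import Relation.Binary.Definitions using (DecidableEquality)
open import Algebra.Bundles using (CommutativeSemiring)

-- Vertices x_{i,j} are encoded as pairs (i , j), 1-indexed as in the paper.
Vertex : Set
Vertex = ℕ × ℕ

Edge : Set
Edge = Vertex × Vertex

_≟ᵥ_ : DecidableEquality Vertex
_≟ᵥ_ = ≡-dec _≟_ _≟_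

range : ℕ → List ℕ
range k = map suc (upTo k)

rowEdges : ℕ → ℕ → List Edge
rowEdges m n = concatMap (λ i → map (λ j → ((i , j) , (i , suc j))) (range (suc (2 *ℕ n)))) (range (suc m))

rungEdges : ℕ → ℕ → List Edge
rungEdges m n = concatMap (λ i → map (λ k → ((i , 2 *ℕ k) , (suc i , 2 *ℕ k ∸ 1))) (range (suc n))) (range m)

HfEdges : ℕ → ℕ → List Edge
HfEdges m n = rowEdges m n ++ rungEdges m n

-- degree of a vertex v in a graph given by its (duplicate-free) edge list
deg : List Edge → Vertex → ℕ
deg E v = length (filter (λ e → (v ≟ᵥ proj₁ e) ⊎-dec (v ≟ᵥ proj₂ e)) E)

module Zagreb {c ℓ : Level} (R : CommutativeSemiring c ℓ) where
  open CommutativeSemiring R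

  _·_ : ℕ → Carrier → Carrier
  zero · x = 0#
  suc k · x = x + (k · x)

  -- General Zagreb index, with  pa d  playing the role of d^a and  pb d  of d^b:
  -- Z = Σ_{uv ∈ E} ( d(u)^a d(v)^b + d(u)^b d(v)^a )
  Z : (pa pb : ℕ → Carrier) → List Edge → Carrier
  Z pa pb E = foldr (λ e acc →
      ((pa (deg E (proj₁ e)) * pb (deg E (proj₂ e)))
       + (pb (deg E (proj₁ e)) * pa (deg E (proj₂ e)))) + acc) 0# E

module Submission where

-- The vertex x_{i+1,2q+1} has degree 1 + [q > 0] + [i > 0] and x_{i+1,2q+2} has degree
-- 1 + [q < n] + [i < m]: besides its neighbours in the row, a vertex carries at most one rung.
-- Going row by row, the first and the last row each contain one edge with end degrees {3,1},
-- one {2,2} and 2n-1 edges {3,2}; every inner row contains 2n-1 edges {3,3} and two {3,2}; every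
-- layer of rungs contains n-1 edges {3,3} and two {3,2}. So H^f[m,n] has 3mn-2m-2n+1 edges {3,3},
-- two {2,2}, 4m+4n-4 edges {3,2} and two {3,1}, and the Zagreb index, a sum over the edges of a
-- symmetric weight of the end degrees, is the corresponding combination of four weights.

open import Defs
open import Level using (Level)
open import Algebra.Bundles using (CommutativeMonoid; CommutativeSemiring)
open import Data.Bool using (true; false; if_then_else_)
open import Data.Empty using (⊥; ⊥-elim)
open import Data.List using (List; []; _∷_; _++_; map; concatMap; filter; length; applyUpTo; upTo; foldr)
open import Data.List.Properties using (filter-++; length-++)
open import Data.Nat using (ℕ; zero; suc; _∸_; _≟_; _≤_; _<_; _≥_; z≤n; s≤s)
  renaming (_+_ to _+ℕ_; _*_ to _*ℕ_)
open import Data.Nat.Properties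
  using (+-0-commutativeMonoid; *-suc; *-cancelˡ-≡; *-distribˡ-+; *-distribʳ-+; *-zeroʳ; suc-injective;
         even≢odd; 1+n≢0; 1+n≢n; m+n∸m≡n; ≤-refl; <⇒≤; m<n⇒m<1+n; n<1+n; *-monoʳ-≤; m≤n⇒m≤1+n)
open import Data.Nat.Tactic.RingSolver using (solve-∀)
open import Data.Product using (_,_; proj₁; proj₂)
open import Data.Sum using (_⊎_)
open import Function using (_∘_)
open import Function.Definitions using (Injective)
open import Relation.Nullary using (Dec; yes; no; does; ¬_)
open import Relation.Nullary.Decidable using (_⊎-dec_)
open import Relation.Binary.PropositionalEquality as ≡ using (_≡_; _≢_; refl; cong; cong₂)

𝟙 : ∀ {p} {P : Set p} → Dec P → ℕ
𝟙 d = if does d then 1 else 0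

𝟙-yes : ∀ {p} {P : Set p} (d : Dec P) → P → 𝟙 d ≡ 1
𝟙-yes (yes _) _ = refl
𝟙-yes (no ¬p) p = ⊥-elim (¬p p)

𝟙-no : ∀ {p} {P : Set p} (d : Dec P) → ¬ P → 𝟙 d ≡ 0
𝟙-no (yes p) ¬p = ⊥-elim (¬p p)
𝟙-no (no _) _ = refl

𝟙-⊎ : ∀ {p q} {P : Set p} {Q : Set q} (d : Dec P) (e : Dec Q) → (P → Q → ⊥) →
      𝟙 (d ⊎-dec e) ≡ 𝟙 d +ℕ 𝟙 e
𝟙-⊎ (yes p) (yes q) disjoint = ⊥-elim (disjoint p q)
𝟙-⊎ (yes _) (no _) _ = refl
𝟙-⊎ (no _) (yes _) _ = refl
𝟙-⊎ (no _) (no _) _ = refl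

𝟙-≟ᵥ : ∀ {i j k l} (i≟k : Dec (i ≡ k)) (j≟l : Dec (j ≡ l)) →
       𝟙 ((i , j) ≟ᵥ (k , l)) ≡ 𝟙 i≟k *ℕ 𝟙 j≟l
𝟙-≟ᵥ {i} {j} (yes refl) (yes refl) = 𝟙-yes ((i , j) ≟ᵥ (i , j)) refl
𝟙-≟ᵥ {i} {j} {k} {l} (yes _) (no j≢l) = 𝟙-no ((i , j) ≟ᵥ (k , l)) (j≢l ∘ cong proj₂)
𝟙-≟ᵥ {i} {j} {k} {l} (no i≢k) _ = 𝟙-no ((i , j) ≟ᵥ (k , l)) (i≢k ∘ cong proj₁)

⟦_<_⟧ : ℕ → ℕ → ℕ
⟦ _ < zero ⟧ = 0
⟦ zero < suc _ ⟧ = 1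
⟦ suc m < suc n ⟧ = ⟦ m < n ⟧

⟦<⟧-true : ∀ {m n} → m < n → ⟦ m < n ⟧ ≡ 1
⟦<⟧-true {zero} {suc _} _ = refl
⟦<⟧-true {suc _} {suc _} (s≤s m<n) = ⟦<⟧-true m<n

⟦<⟧-irrefl : ∀ n → ⟦ n < n ⟧ ≡ 0
⟦<⟧-irrefl zero = refl
⟦<⟧-irrefl (suc n) = ⟦<⟧-irrefl n

⟦2*<2*⟧ : ∀ m n → ⟦ 2 *ℕ m < 2 *ℕ n ⟧ ≡ ⟦ m < n ⟧
⟦2*<2*⟧ zero zero = refl
⟦2*<2*⟧ zero (suc n) = refl
⟦2*<2*⟧ (suc m) zero = refl
⟦2*<2*⟧ (suc m) (suc n) = ≡.trans (cong₂ ⟦_<_⟧ (*-suc 2 m) (*-suc 2 n)) (⟦2*<2*⟧ m n)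

module RangeSum {c ℓ} (M : CommutativeMonoid c ℓ) where

  open CommutativeMonoid M renaming (refl to ≈-refl)
  open import Algebra.Properties.CommutativeSemigroup commutativeSemigroup using (interchange)
  open import Algebra.Properties.CommutativeMonoid.Mult M using (_×_)
  open import Relation.Binary.Reasoning.Setoid setoid

  sumOf : ∀ {a} {A : Set a} → (A → Carrier) → List A → Carrier
  sumOf φ = foldr (λ x acc → φ x ∙ acc) ε

  Σ< : ℕ → (ℕ → Carrier) → Carrier
  Σ< zero h = ε
  Σ< (suc k) h = h 0 ∙ Σ< k (h ∘ suc)

  sumOf-++ : ∀ {a} {A : Set a} (φ : A → Carrier) xs ys → sumOf φ (xs ++ ys) ≈ sumOf φ xs ∙ sumOf φ ys
  sumOf-++ φ [] ys = sym (identityˡ _)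
  sumOf-++ φ (x ∷ xs) ys = trans (∙-congˡ (sumOf-++ φ xs ys)) (sym (assoc _ _ _))

  sumOf-map : ∀ {a b} {A : Set a} {B : Set b} (φ : B → Carrier) (f : A → B) xs →
              sumOf φ (map f xs) ≈ sumOf (φ ∘ f) xs
  sumOf-map φ f [] = ≈-refl
  sumOf-map φ f (x ∷ xs) = ∙-congˡ (sumOf-map φ f xs)

  sumOf-concatMap : ∀ {a b} {A : Set a} {B : Set b} (φ : B → Carrier) (f : A → List B) xs →
                    sumOf φ (concatMap f xs) ≈ sumOf (sumOf φ ∘ f) xs
  sumOf-concatMap φ f [] = ≈-refl
  sumOf-concatMap φ f (x ∷ xs) =
    trans (sumOf-++ φ (f x) (concatMap f xs)) (∙-congˡ (sumOf-concatMap φ f xs))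

  Σ<-cong : ∀ k {h h′ : ℕ → Carrier} → (∀ x → x < k → h x ≈ h′ x) → Σ< k h ≈ Σ< k h′
  Σ<-cong zero eq = ≈-refl
  Σ<-cong (suc k) eq = ∙-cong (eq 0 (s≤s z≤n)) (Σ<-cong k (λ x x<k → eq (suc x) (s≤s x<k)))

  Σ<-const : ∀ k {h : ℕ → Carrier} {v} → (∀ x → x < k → h x ≈ v) → Σ< k h ≈ k × v
  Σ<-const zero eq = ≈-refl
  Σ<-const (suc k) eq = ∙-cong (eq 0 (s≤s z≤n)) (Σ<-const k (λ x x<k → eq (suc x) (s≤s x<k)))

  Σ<-last : ∀ k h → Σ< (suc k) h ≈ Σ< k h ∙ h k
  Σ<-last zero h = trans (identityʳ _) (sym (identityˡ _))
  Σ<-last (suc k) h = trans (∙-congˡ (Σ<-last k (h ∘ suc))) (sym (assoc _ _ _))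

  Σ<-∙ : ∀ k (f g : ℕ → Carrier) → Σ< k (λ x → f x ∙ g x) ≈ Σ< k f ∙ Σ< k g
  Σ<-∙ zero f g = sym (identityˡ _)
  Σ<-∙ (suc k) f g = trans (∙-congˡ (Σ<-∙ k (f ∘ suc) (g ∘ suc))) (interchange _ _ _ _)

  Σ<-pairs : ∀ k h → Σ< (2 *ℕ k) h ≈ Σ< k (λ q → h (2 *ℕ q) ∙ h (suc (2 *ℕ q)))
  Σ<-pairs zero h = ≈-refl
  Σ<-pairs (suc k) h = begin
    Σ< (2 *ℕ suc k) h                               ≡⟨ cong (λ l → Σ< l h) (*-suc 2 k) ⟩
    h 0 ∙ (h 1 ∙ Σ< (2 *ℕ k) (h ∘ suc ∘ suc))        ≈⟨ sym (assoc _ _ _) ⟩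
    h 0 ∙ h 1 ∙ Σ< (2 *ℕ k) (h ∘ suc ∘ suc)          ≈⟨ ∙-congˡ (Σ<-pairs k (h ∘ suc ∘ suc)) ⟩
    h 0 ∙ h 1 ∙ Σ< k (λ q → h (2 +ℕ 2 *ℕ q) ∙ h (3 +ℕ 2 *ℕ q))
      ≈⟨ ∙-congˡ (Σ<-cong k (λ q _ → reflexive (≡.sym (cong (λ j → h j ∙ h (suc j)) (*-suc 2 q))))) ⟩
    Σ< (suc k) (λ q → h (2 *ℕ q) ∙ h (suc (2 *ℕ q))) ∎

  sumOf-range : ∀ (φ : ℕ → Carrier) k → sumOf φ (range k) ≈ Σ< k (φ ∘ suc)
  sumOf-range φ k = trans (sumOf-map φ suc (upTo k)) (applyUpTo-sum (φ ∘ suc) (λ x → x) k)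
    where
    applyUpTo-sum : ∀ (φ : ℕ → Carrier) f k → sumOf φ (applyUpTo f k) ≈ Σ< k (φ ∘ f)
    applyUpTo-sum φ f zero = ≈-refl
    applyUpTo-sum φ f (suc k) = ∙-congˡ (applyUpTo-sum φ (f ∘ suc) k)

  sumOf-grid : ∀ {b} {B : Set b} (φ : B → Carrier) (e : ℕ → ℕ → B) M K →
               sumOf φ (concatMap (λ i → map (e i) (range K)) (range M))
               ≈ Σ< M (λ x → Σ< K (λ y → φ (e (suc x) (suc y))))
  sumOf-grid φ e M K = begin
    sumOf φ (concatMap (λ i → map (e i) (range K)) (range M))
      ≈⟨ sumOf-concatMap φ (λ i → map (e i) (range K)) (range M) ⟩
    sumOf (λ i → sumOf φ (map (e i) (range K))) (range M)
      ≈⟨ sumOf-range _ M ⟩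
    Σ< M (λ x → sumOf φ (map (e (suc x)) (range K)))
      ≈⟨ Σ<-cong M (λ x _ → trans (sumOf-map φ (e (suc x)) (range K)) (sumOf-range _ K)) ⟩
    Σ< M (λ x → Σ< K (λ y → φ (e (suc x) (suc y)))) ∎

module Degrees where

  open RangeSum +-0-commutativeMonoid
  open ≡ using (sym; trans)
  open ≡.≡-Reasoning

  Σ<-*ˡ : ∀ k c (g : ℕ → ℕ) → Σ< k (λ x → c *ℕ g x) ≡ c *ℕ Σ< k g
  Σ<-*ˡ zero c g = sym (*-zeroʳ c)
  Σ<-*ˡ (suc k) c g = trans (cong (c *ℕ g 0 +ℕ_) (Σ<-*ˡ k c (g ∘ suc))) (sym (*-distribˡ-+ c (g 0) _))

  Σ<-*ʳ : ∀ k c (f : ℕ → ℕ) → Σ< k (λ x → f x *ℕ c) ≡ Σ< k f *ℕ c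
  Σ<-*ʳ zero c f = refl
  Σ<-*ʳ (suc k) c f = trans (cong (f 0 *ℕ c +ℕ_) (Σ<-*ʳ k c (f ∘ suc))) (sym (*-distribʳ-+ c (f 0) _))

  Σ<-product : ∀ M K (f g : ℕ → ℕ) → Σ< M (λ x → Σ< K (λ y → f x *ℕ g y)) ≡ Σ< M f *ℕ Σ< K g
  Σ<-product M K f g = trans (Σ<-cong M (λ x _ → Σ<-*ˡ K (f x) g)) (Σ<-*ʳ M (Σ< K g) f)

  occurrences : (ℕ → ℕ) → ℕ → ℕ → ℕ
  occurrences f k t = Σ< k (λ x → 𝟙 (t ≟ f x))

  occurrences-cong : ∀ {f g : ℕ → ℕ} k t → (∀ x → f x ≡ g x) → occurrences f k t ≡ occurrences g k t
  occurrences-cong {f} k t f≗g = Σ<-cong k (λ x _ → cong (λ v → 𝟙 (t ≟ v)) (f≗g x))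

  occurrences-absent : ∀ f k t → (∀ x → f x ≢ t) → occurrences f k t ≡ 0
  occurrences-absent f zero t absent = refl
  occurrences-absent f (suc k) t absent =
    cong₂ _+ℕ_ (𝟙-no (t ≟ f 0) (absent 0 ∘ sym)) (occurrences-absent (f ∘ suc) k t (absent ∘ suc))

  occurrences-injective : ∀ {f} → Injective _≡_ _≡_ f → ∀ k s → occurrences f k (f s) ≡ ⟦ s < k ⟧
  occurrences-injective inj zero s = refl
  occurrences-injective {f} inj (suc k) zero =
    cong₂ _+ℕ_ (𝟙-yes (f 0 ≟ f 0) refl) (occurrences-absent (f ∘ suc) k (f 0) (λ x → 1+n≢0 ∘ inj))
  occurrences-injective {f} inj (suc k) (suc s) =
    cong₂ _+ℕ_ (𝟙-no (f (suc s) ≟ f 0) (1+n≢0 ∘ inj)) (occurrences-injective (suc-injective ∘ inj) k s)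

  length-filter≡sumOf-𝟙 : ∀ {a p} {A : Set a} {P : A → Set p} (P? : ∀ x → Dec (P x)) xs →
                          length (filter P? xs) ≡ sumOf (𝟙 ∘ P?) xs
  length-filter≡sumOf-𝟙 P? [] = refl
  length-filter≡sumOf-𝟙 P? (x ∷ xs) with does (P? x)
  ... | true  = cong suc (length-filter≡sumOf-𝟙 P? xs)
  ... | false = length-filter≡sumOf-𝟙 P? xs

  deg-++ : ∀ E F v → deg (E ++ F) v ≡ deg E v +ℕ deg F v
  deg-++ E F v = trans (cong length (filter-++ _ E F)) (length-++ (filter _ E))

  deg-grid : ∀ (r₁ c₁ r₂ c₂ : ℕ → ℕ) M K a b → (∀ i j → (r₁ i , c₁ j) ≢ (r₂ i , c₂ j)) →
    deg (concatMap (λ i → map (λ j → ((r₁ i , c₁ j) , (r₂ i , c₂ j))) (range K)) (range M)) (a , b)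
    ≡ occurrences (r₁ ∘ suc) M a *ℕ occurrences (c₁ ∘ suc) K b
      +ℕ occurrences (r₂ ∘ suc) M a *ℕ occurrences (c₂ ∘ suc) K b
  deg-grid r₁ c₁ r₂ c₂ M K a b loopless = begin
    length (filter incident? grid)
      ≡⟨ length-filter≡sumOf-𝟙 incident? grid ⟩
    sumOf (𝟙 ∘ incident?) grid
      ≡⟨ sumOf-grid (𝟙 ∘ incident?) edge M K ⟩
    Σ< M (λ x → Σ< K (λ y → 𝟙 (incident? (edge (suc x) (suc y)))))
      ≡⟨ Σ<-cong M (λ x _ → Σ<-cong K (λ y _ → incidence x y)) ⟩
    Σ< M (λ x → Σ< K (λ y → f₁ x *ℕ g₁ y +ℕ f₂ x *ℕ g₂ y))
      ≡⟨ Σ<-cong M (λ x _ → Σ<-∙ K _ _) ⟩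
    Σ< M (λ x → Σ< K (λ y → f₁ x *ℕ g₁ y) +ℕ Σ< K (λ y → f₂ x *ℕ g₂ y))
      ≡⟨ Σ<-∙ M _ _ ⟩
    Σ< M (λ x → Σ< K (λ y → f₁ x *ℕ g₁ y)) +ℕ Σ< M (λ x → Σ< K (λ y → f₂ x *ℕ g₂ y))
      ≡⟨ cong₂ _+ℕ_ (Σ<-product M K f₁ g₁) (Σ<-product M K f₂ g₂) ⟩
    Σ< M f₁ *ℕ Σ< K g₁ +ℕ Σ< M f₂ *ℕ Σ< K g₂ ∎
    where
    edge : ℕ → ℕ → Edge
    edge i j = ((r₁ i , c₁ j) , (r₂ i , c₂ j))
    grid : List Edge
    grid = concatMap (λ i → map (edge i) (range K)) (range M)
    incident? : ∀ e → Dec ((a , b) ≡ proj₁ e ⊎ (a , b) ≡ proj₂ e)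
    incident? e = ((a , b) ≟ᵥ proj₁ e) ⊎-dec ((a , b) ≟ᵥ proj₂ e)
    f₁ f₂ g₁ g₂ : ℕ → ℕ
    f₁ x = 𝟙 (a ≟ r₁ (suc x))
    g₁ y = 𝟙 (b ≟ c₁ (suc y))
    f₂ x = 𝟙 (a ≟ r₂ (suc x))
    g₂ y = 𝟙 (b ≟ c₂ (suc y))
    incidence : ∀ x y → 𝟙 (incident? (edge (suc x) (suc y))) ≡ f₁ x *ℕ g₁ y +ℕ f₂ x *ℕ g₂ y
    incidence x y =
      trans (𝟙-⊎ ((a , b) ≟ᵥ (r₁ (suc x) , c₁ (suc y))) ((a , b) ≟ᵥ (r₂ (suc x) , c₂ (suc y)))
                 (λ p q → loopless (suc x) (suc y) (trans (sym p) q)))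
            (cong₂ _+ℕ_ (𝟙-≟ᵥ (a ≟ r₁ (suc x)) (b ≟ c₁ (suc y))) (𝟙-≟ᵥ (a ≟ r₂ (suc x)) (b ≟ c₂ (suc y))))

  -- The four products count the right, left, lower and upper neighbours of (a , b).
  deg-HfEdges : ∀ m n a b → deg (HfEdges m n) (a , b) ≡
    (occurrences suc (suc m) a *ℕ occurrences suc (suc (2 *ℕ n)) b
     +ℕ occurrences suc (suc m) a *ℕ occurrences (suc ∘ suc) (suc (2 *ℕ n)) b)
    +ℕ (occurrences suc m a *ℕ occurrences (λ k → 2 *ℕ suc k) (suc n) b
       +ℕ occurrences (suc ∘ suc) m a *ℕ occurrences (λ k → 2 *ℕ suc k ∸ 1) (suc n) b)
  deg-HfEdges m n a b = trans (deg-++ (rowEdges m n) (rungEdges m n) (a , b)) (cong₂ _+ℕ_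
    (deg-grid (λ i → i) (λ j → j) (λ i → i) suc (suc m) (suc (2 *ℕ n)) a b (λ i j → 1+n≢n ∘ sym ∘ cong proj₂))
    (deg-grid (λ i → i) (λ k → 2 *ℕ k) suc (λ k → 2 *ℕ k ∸ 1) m (suc n) a b (λ i j → 1+n≢n ∘ sym ∘ cong proj₁)))

  occurrences-suc : ∀ k s → occurrences suc k (suc s) ≡ ⟦ s < k ⟧
  occurrences-suc = occurrences-injective suc-injective

  occurrences-suc∘suc : ∀ {k i} → i ≤ k → occurrences (suc ∘ suc) k (suc i) ≡ ⟦ 0 < i ⟧
  occurrences-suc∘suc {k} {zero} _ = occurrences-absent (suc ∘ suc) k 1 (λ x ())
  occurrences-suc∘suc {k} {suc i} i<k =
    trans (occurrences-injective (suc-injective ∘ suc-injective) k i) (⟦<⟧-true i<k)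

  occurrences-odd : ∀ k t → occurrences (λ x → 2 *ℕ suc x ∸ 1) k t ≡ occurrences (λ x → suc (2 *ℕ x)) k t
  occurrences-odd k t = occurrences-cong k t (λ x → cong (_∸ 1) (*-suc 2 x))

  2*-injective : Injective _≡_ _≡_ (2 *ℕ_)
  2*-injective = *-cancelˡ-≡ _ _ 2

  deg-odd : ∀ m n {i q} → i ≤ m → q ≤ n →
            deg (HfEdges m n) (suc i , suc (2 *ℕ q)) ≡ suc (⟦ 0 < q ⟧ +ℕ ⟦ 0 < i ⟧)
  deg-odd m n {i} {q} i≤m q≤n = begin
    deg (HfEdges m n) (suc i , suc (2 *ℕ q))
      ≡⟨ deg-HfEdges m n (suc i) (suc (2 *ℕ q)) ⟩
    _ ≡⟨ cong₂ _+ℕ_ (cong₂ _+ℕ_ (cong₂ _*ℕ_ rowInRange rightward) (cong₂ _*ℕ_ rowInRange leftward))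
                    (cong₂ _+ℕ_ (cong (occurrences suc m (suc i) *ℕ_) rungDown) (cong₂ _*ℕ_ rowAbove rungUp)) ⟩
    1 *ℕ 1 +ℕ 1 *ℕ ⟦ 0 < q ⟧ +ℕ (occurrences suc m (suc i) *ℕ 0 +ℕ ⟦ 0 < i ⟧ *ℕ 1)
      ≡⟨ arith ⟦ 0 < q ⟧ ⟦ 0 < i ⟧ (occurrences suc m (suc i)) ⟩
    suc (⟦ 0 < q ⟧ +ℕ ⟦ 0 < i ⟧) ∎
    where
    rowInRange : occurrences suc (suc m) (suc i) ≡ 1
    rowInRange = trans (occurrences-suc (suc m) i) (⟦<⟧-true (s≤s i≤m))
    rightward : occurrences suc (suc (2 *ℕ n)) (suc (2 *ℕ q)) ≡ 1
    rightward = trans (occurrences-suc (suc (2 *ℕ n)) (2 *ℕ q)) (⟦<⟧-true (s≤s (*-monoʳ-≤ 2 q≤n)))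
    leftward : occurrences (suc ∘ suc) (suc (2 *ℕ n)) (suc (2 *ℕ q)) ≡ ⟦ 0 < q ⟧
    leftward = trans (occurrences-suc∘suc (m≤n⇒m≤1+n (*-monoʳ-≤ 2 q≤n))) (⟦0<2*⟧ q)
      where
      ⟦0<2*⟧ : ∀ q → ⟦ 0 < 2 *ℕ q ⟧ ≡ ⟦ 0 < q ⟧
      ⟦0<2*⟧ zero = refl
      ⟦0<2*⟧ (suc q) = cong (λ v → ⟦ 0 < v ⟧) (*-suc 2 q)
    rungDown : occurrences (λ k → 2 *ℕ suc k) (suc n) (suc (2 *ℕ q)) ≡ 0
    rungDown = occurrences-absent (λ k → 2 *ℕ suc k) (suc n) (suc (2 *ℕ q)) (λ k → even≢odd (suc k) q)
    rowAbove : occurrences (suc ∘ suc) m (suc i) ≡ ⟦ 0 < i ⟧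
    rowAbove = occurrences-suc∘suc i≤m
    rungUp : occurrences (λ k → 2 *ℕ suc k ∸ 1) (suc n) (suc (2 *ℕ q)) ≡ 1
    rungUp = trans (occurrences-odd (suc n) (suc (2 *ℕ q)))
                   (trans (occurrences-injective (2*-injective ∘ suc-injective) (suc n) q) (⟦<⟧-true (s≤s q≤n)))
    arith : ∀ x y z → 1 *ℕ 1 +ℕ 1 *ℕ x +ℕ (z *ℕ 0 +ℕ y *ℕ 1) ≡ suc (x +ℕ y)
    arith = solve-∀

  deg-even : ∀ m n {i q} → i ≤ m → q ≤ n →
             deg (HfEdges m n) (suc i , suc (suc (2 *ℕ q))) ≡ suc (⟦ q < n ⟧ +ℕ ⟦ i < m ⟧)
  deg-even m n {i} {q} i≤m q≤n = begin
    deg (HfEdges m n) (suc i , suc (suc (2 *ℕ q)))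
      ≡⟨ deg-HfEdges m n (suc i) (suc (suc (2 *ℕ q))) ⟩
    _ ≡⟨ cong₂ _+ℕ_ (cong₂ _+ℕ_ (cong₂ _*ℕ_ rowInRange rightward) (cong₂ _*ℕ_ rowInRange leftward))
                    (cong₂ _+ℕ_ (cong₂ _*ℕ_ rowBelow rungDown) (cong (occurrences (suc ∘ suc) m (suc i) *ℕ_) rungUp)) ⟩
    1 *ℕ ⟦ q < n ⟧ +ℕ 1 *ℕ 1 +ℕ (⟦ i < m ⟧ *ℕ 1 +ℕ occurrences (suc ∘ suc) m (suc i) *ℕ 0)
      ≡⟨ arith ⟦ q < n ⟧ ⟦ i < m ⟧ (occurrences (suc ∘ suc) m (suc i)) ⟩
    suc (⟦ q < n ⟧ +ℕ ⟦ i < m ⟧) ∎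
    where
    rowInRange : occurrences suc (suc m) (suc i) ≡ 1
    rowInRange = trans (occurrences-suc (suc m) i) (⟦<⟧-true (s≤s i≤m))
    rightward : occurrences suc (suc (2 *ℕ n)) (suc (suc (2 *ℕ q))) ≡ ⟦ q < n ⟧
    rightward = trans (occurrences-suc (suc (2 *ℕ n)) (suc (2 *ℕ q))) (⟦2*<2*⟧ q n)
    leftward : occurrences (suc ∘ suc) (suc (2 *ℕ n)) (suc (suc (2 *ℕ q))) ≡ 1
    leftward = occurrences-suc∘suc (s≤s (*-monoʳ-≤ 2 q≤n))
    rowBelow : occurrences suc m (suc i) ≡ ⟦ i < m ⟧
    rowBelow = occurrences-suc m i
    rungDown : occurrences (λ k → 2 *ℕ suc k) (suc n) (suc (suc (2 *ℕ q))) ≡ 1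
    rungDown = trans (cong (occurrences (λ k → 2 *ℕ suc k) (suc n)) (sym (*-suc 2 q)))
                     (trans (occurrences-injective (suc-injective ∘ 2*-injective) (suc n) q) (⟦<⟧-true (s≤s q≤n)))
    rungUp : occurrences (λ k → 2 *ℕ suc k ∸ 1) (suc n) (suc (suc (2 *ℕ q))) ≡ 0
    rungUp = trans (occurrences-odd (suc n) (suc (suc (2 *ℕ q))))
                   (occurrences-absent (λ k → suc (2 *ℕ k)) (suc n) _ (λ k → even≢odd k q ∘ suc-injective))
    arith : ∀ x y z → 1 *ℕ x +ℕ 1 *ℕ 1 +ℕ (y *ℕ 1 +ℕ z *ℕ 0) ≡ suc (x +ℕ y)
    arith = solve-∀

record EdgeCensus : Set where
  constructor census
  field n₃₃ n₂₂ n₃₂ n₃₁ : ℕ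

open EdgeCensus

infixl 6 _⊕_
infixr 7 _⊛_

_⊕_ : EdgeCensus → EdgeCensus → EdgeCensus
u ⊕ v = census (n₃₃ u +ℕ n₃₃ v) (n₂₂ u +ℕ n₂₂ v) (n₃₂ u +ℕ n₃₂ v) (n₃₁ u +ℕ n₃₁ v)

-- Scaling multiplies on the right, so that zero counts stay definitionally zero.
_⊛_ : ℕ → EdgeCensus → EdgeCensus
k ⊛ u = census (n₃₃ u *ℕ k) (n₂₂ u *ℕ k) (n₃₂ u *ℕ k) (n₃₁ u *ℕ k)

module EdgeWeightSum {c ℓ} (M : CommutativeMonoid c ℓ)
                     (w : ℕ → ℕ → CommutativeMonoid.Carrier M)
                     (w-sym : ∀ a b → CommutativeMonoid._≈_ M (w a b) (w b a)) where

  open CommutativeMonoid M renaming (refl to ≈-refl)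
  open RangeSum M
  open import Algebra.Properties.CommutativeMonoid.Mult M
    using (_×_; ×-homo-+; ×-distrib-+; ×-assocˡ; ×-congˡ)
  open import Algebra.Properties.CommutativeSemigroup commutativeSemigroup using (interchange)
  open import Relation.Binary.Reasoning.Setoid setoid
  open import Data.Nat.Properties using (*-comm)

  edgeWeight : List Edge → Edge → Carrier
  edgeWeight E e = w (deg E (proj₁ e)) (deg E (proj₂ e))

  -- Opaque, so that a census can be recovered by unification from the weight it denotes.
  opaque
    weightOf : EdgeCensus → Carrier
    weightOf (census a b c d) = a × w 3 3 ∙ b × w 2 2 ∙ c × w 3 2 ∙ d × w 3 1

  opaque
    unfolding weightOf

    weightOf-⊕ : ∀ u v → weightOf u ∙ weightOf v ≈ weightOf (u ⊕ v)
    weightOf-⊕ (census a b c d) (census a′ b′ c′ d′) = begin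
      (a × w 3 3 ∙ b × w 2 2 ∙ c × w 3 2 ∙ d × w 3 1) ∙ (a′ × w 3 3 ∙ b′ × w 2 2 ∙ c′ × w 3 2 ∙ d′ × w 3 1)
        ≈⟨ trans (interchange _ _ _ _) (∙-congʳ (trans (interchange _ _ _ _) (∙-congʳ (interchange _ _ _ _)))) ⟩
      (a × w 3 3 ∙ a′ × w 3 3) ∙ (b × w 2 2 ∙ b′ × w 2 2) ∙ (c × w 3 2 ∙ c′ × w 3 2) ∙ (d × w 3 1 ∙ d′ × w 3 1)
        ≈⟨ sym (∙-cong (∙-cong (∙-cong (×-homo-+ _ a a′) (×-homo-+ _ b b′)) (×-homo-+ _ c c′)) (×-homo-+ _ d d′)) ⟩
      weightOf (census (a +ℕ a′) (b +ℕ b′) (c +ℕ c′) (d +ℕ d′)) ∎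

    weightOf-census : ∀ a b c d → weightOf (census a b c d) ≈ a × w 3 3 ∙ b × w 2 2 ∙ c × w 3 2 ∙ d × w 3 1
    weightOf-census a b c d = ≈-refl

    weightOf-⊛ : ∀ k u → k × weightOf u ≈ weightOf (k ⊛ u)
    weightOf-⊛ k (census a b c d) = begin
      k × (a × w 3 3 ∙ b × w 2 2 ∙ c × w 3 2 ∙ d × w 3 1)
        ≈⟨ trans (×-distrib-+ _ _ k) (∙-congʳ (trans (×-distrib-+ _ _ k) (∙-congʳ (×-distrib-+ _ _ k)))) ⟩
      k × (a × w 3 3) ∙ k × (b × w 2 2) ∙ k × (c × w 3 2) ∙ k × (d × w 3 1)
        ≈⟨ ∙-cong (∙-cong (∙-cong (scale a) (scale b)) (scale c)) (scale d) ⟩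
      weightOf (k ⊛ census a b c d) ∎
      where
      scale : ∀ a {x} → k × (a × x) ≈ (a *ℕ k) × x
      scale a = trans (×-assocˡ _ k a) (×-congˡ (*-comm k a))

    w₃₃ : w 3 3 ≈ weightOf (census 1 0 0 0)
    w₃₃ = sym (trans (identityʳ _) (trans (identityʳ _) (trans (identityʳ _) (identityʳ _))))

    w₂₂ : w 2 2 ≈ weightOf (census 0 1 0 0)
    w₂₂ = sym (trans (identityʳ _) (trans (identityʳ _) (trans (identityˡ _) (identityʳ _))))

    w₃₂ : w 3 2 ≈ weightOf (census 0 0 1 0)
    w₃₂ = sym (trans (identityʳ _) (trans (∙-cong (identityʳ _) (identityʳ _)) (identityˡ _)))

    w₃₁ : w 3 1 ≈ weightOf (census 0 0 0 1)
    w₃₁ = sym (trans (∙-cong (trans (identityʳ _) (identityʳ _)) (identityʳ _)) (identityˡ _))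

  ∙-weightOf : ∀ {x y u v} → x ≈ weightOf u → y ≈ weightOf v → x ∙ y ≈ weightOf (u ⊕ v)
  ∙-weightOf {u = u} {v} x≈ y≈ = trans (∙-cong x≈ y≈) (weightOf-⊕ u v)

  Σ<-weightOf : ∀ k {h} u → (∀ x → x < k → h x ≈ weightOf u) → Σ< k h ≈ weightOf (k ⊛ u)
  Σ<-weightOf k u h≈ = trans (Σ<-const k h≈) (weightOf-⊛ k u)

  w₂₃ : w 2 3 ≈ weightOf (census 0 0 1 0)
  w₂₃ = trans (w-sym 2 3) w₃₂

  w₁₃ : w 1 3 ≈ weightOf (census 0 0 0 1)
  w₁₃ = trans (w-sym 1 3) w₃₁

  module _ (m₀ n₀ : ℕ) where

    private
      m n : ℕ
      m = suc m₀
      n = suc n₀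
      E : List Edge
      E = HfEdges m n

    rowWeight rungWeight : ℕ → Carrier
    rowWeight x = Σ< (suc (2 *ℕ n)) (λ y → edgeWeight E ((suc x , suc y) , (suc x , suc (suc y))))
    rungWeight x = Σ< (suc n) (λ y → edgeWeight E ((suc x , 2 *ℕ suc y) , (suc (suc x) , 2 *ℕ suc y ∸ 1)))

    HfEdges-rows-rungs : sumOf (edgeWeight E) E ≈ Σ< (suc m) rowWeight ∙ Σ< m rungWeight
    HfEdges-rows-rungs = trans (sumOf-++ (edgeWeight E) (rowEdges m n) (rungEdges m n))
      (∙-cong (sumOf-grid (edgeWeight E) (λ i j → ((i , j) , (i , suc j))) (suc m) (suc (2 *ℕ n)))
              (sumOf-grid (edgeWeight E) (λ i k → ((i , 2 *ℕ k) , (suc i , 2 *ℕ k ∸ 1))) m (suc n)))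

    rowWeight-shape : ∀ x {α β} → x ≤ m → ⟦ 0 < x ⟧ ≡ α → ⟦ x < m ⟧ ≡ β →
      rowWeight x ≈ w (suc α) (2 +ℕ β)
                    ∙ (Σ< n₀ (λ _ → w (2 +ℕ β) (2 +ℕ α) ∙ w (2 +ℕ α) (2 +ℕ β))
                       ∙ (w (2 +ℕ β) (2 +ℕ α) ∙ w (2 +ℕ α) (suc β)))
    rowWeight-shape x {α} {β} x≤m refl refl = begin
      rowWeight x                   ≈⟨ ∙-congˡ (Σ<-pairs n (h ∘ suc)) ⟩
      h 0 ∙ Σ< n pair               ≈⟨ ∙-congˡ (Σ<-last n₀ pair) ⟩
      h 0 ∙ (Σ< n₀ pair ∙ pair n₀)  ≈⟨ ∙-cong (reflexive first) (∙-cong (Σ<-cong n₀ pair-inner) (reflexive pair-last)) ⟩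
      w (suc α) (2 +ℕ β)
        ∙ (Σ< n₀ (λ _ → w (2 +ℕ β) (2 +ℕ α) ∙ w (2 +ℕ α) (2 +ℕ β))
           ∙ (w (2 +ℕ β) (2 +ℕ α) ∙ w (2 +ℕ α) (suc β))) ∎
      where
      open Degrees using (deg-odd; deg-even)
      h : ℕ → Carrier
      h y = edgeWeight E ((suc x , suc y) , (suc x , suc (suc y)))
      pair : ℕ → Carrier
      pair q = h (suc (2 *ℕ q)) ∙ h (suc (suc (2 *ℕ q)))
      first : h 0 ≡ w (suc α) (2 +ℕ β)
      first = cong₂ w (deg-odd m n x≤m z≤n) (deg-even m n x≤m z≤n)
      pair-degrees : ∀ {q} → q ≤ n₀ →
                     pair q ≡ w (suc (⟦ q < n ⟧ +ℕ β)) (2 +ℕ α) ∙ w (2 +ℕ α) (suc (⟦ q < n₀ ⟧ +ℕ β))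
      pair-degrees {q} q≤n₀ = cong₂ _∙_ (cong₂ w (deg-even m n x≤m (m≤n⇒m≤1+n q≤n₀)) odd) (cong₂ w odd even)
        where
        odd : deg E (suc x , suc (suc (suc (2 *ℕ q)))) ≡ 2 +ℕ α
        odd = ≡.trans (cong (λ j → deg E (suc x , suc j)) (≡.sym (*-suc 2 q))) (deg-odd m n x≤m (s≤s q≤n₀))
        even : deg E (suc x , suc (suc (suc (suc (2 *ℕ q))))) ≡ suc (⟦ q < n₀ ⟧ +ℕ β)
        even = ≡.trans (cong (λ j → deg E (suc x , suc (suc j))) (≡.sym (*-suc 2 q))) (deg-even m n x≤m (s≤s q≤n₀))
      pair-inner : ∀ q → q < n₀ → pair q ≈ w (2 +ℕ β) (2 +ℕ α) ∙ w (2 +ℕ α) (2 +ℕ β)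
      pair-inner q q<n₀ = reflexive (≡.trans (pair-degrees (<⇒≤ q<n₀))
        (cong₂ (λ s t → w (suc (s +ℕ β)) (2 +ℕ α) ∙ w (2 +ℕ α) (suc (t +ℕ β)))
               (⟦<⟧-true (m<n⇒m<1+n q<n₀)) (⟦<⟧-true q<n₀)))
      pair-last : pair n₀ ≡ w (2 +ℕ β) (2 +ℕ α) ∙ w (2 +ℕ α) (suc β)
      pair-last = ≡.trans (pair-degrees ≤-refl)
        (cong₂ (λ s t → w (suc (s +ℕ β)) (2 +ℕ α) ∙ w (2 +ℕ α) (suc (t +ℕ β)))
               (⟦<⟧-true (n<1+n n₀)) (⟦<⟧-irrefl n₀))

    rungWeight-shape : ∀ x → x < m → rungWeight x ≈ w 3 2 ∙ (Σ< n₀ (λ _ → w 3 3) ∙ w 2 3)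
    rungWeight-shape x x<m = begin
      rungWeight x                   ≈⟨ ∙-congˡ (Σ<-last n₀ (r ∘ suc)) ⟩
      r 0 ∙ (Σ< n₀ (r ∘ suc) ∙ r n)  ≈⟨ ∙-cong (reflexive (rung-degrees z≤n))
                                              (∙-cong (Σ<-cong n₀ rung-inner) (reflexive rung-last)) ⟩
      w 3 2 ∙ (Σ< n₀ (λ _ → w 3 3) ∙ w 2 3) ∎
      where
      open Degrees using (deg-odd; deg-even)
      r : ℕ → Carrier
      r y = edgeWeight E ((suc x , 2 *ℕ suc y) , (suc (suc x) , 2 *ℕ suc y ∸ 1))
      rung-degrees : ∀ {y} → y ≤ n → r y ≡ w (suc (⟦ y < n ⟧ +ℕ 1)) (suc (⟦ 0 < y ⟧ +ℕ 1))
      rung-degrees {y} y≤n = cong₂ w upper lower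
        where
        upper : deg E (suc x , 2 *ℕ suc y) ≡ suc (⟦ y < n ⟧ +ℕ 1)
        upper = ≡.trans (cong (λ j → deg E (suc x , j)) (*-suc 2 y))
                        (≡.trans (deg-even m n (<⇒≤ x<m) y≤n) (cong (λ t → suc (⟦ y < n ⟧ +ℕ t)) (⟦<⟧-true x<m)))
        lower : deg E (suc (suc x) , 2 *ℕ suc y ∸ 1) ≡ suc (⟦ 0 < y ⟧ +ℕ 1)
        lower = ≡.trans (cong (λ j → deg E (suc (suc x) , j ∸ 1)) (*-suc 2 y)) (deg-odd m n x<m y≤n)
      rung-inner : ∀ q → q < n₀ → r (suc q) ≈ w 3 3
      rung-inner q q<n₀ = reflexive (≡.trans (rung-degrees (s≤s (<⇒≤ q<n₀)))
                                             (cong (λ s → w (suc (s +ℕ 1)) 3) (⟦<⟧-true q<n₀)))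
      rung-last : r n ≡ w 2 3
      rung-last = ≡.trans (rung-degrees ≤-refl) (cong (λ s → w (suc (s +ℕ 1)) 3) (⟦<⟧-irrefl n₀))

    rowWeight-first : rowWeight 0 ≈ weightOf (census 0 1 (2 *ℕ n₀ +ℕ 1) 1)
    rowWeight-first = trans (rowWeight-shape 0 z≤n refl refl)
      (∙-weightOf w₁₃ (∙-weightOf (Σ<-weightOf n₀ (census 0 0 2 0) (λ _ _ → ∙-weightOf w₃₂ w₂₃)) (∙-weightOf w₃₂ w₂₂)))

    rowWeight-inner : ∀ x → x < m₀ → rowWeight (suc x) ≈ weightOf (census (2 *ℕ n₀ +ℕ 1) 0 2 0)
    rowWeight-inner x x<m₀ = trans (rowWeight-shape (suc x) (s≤s (<⇒≤ x<m₀)) refl (⟦<⟧-true x<m₀))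
      (∙-weightOf w₂₃ (∙-weightOf (Σ<-weightOf n₀ (census 2 0 0 0) (λ _ _ → ∙-weightOf w₃₃ w₃₃)) (∙-weightOf w₃₃ w₃₂)))

    rowWeight-last : rowWeight m ≈ weightOf (census 0 1 (2 *ℕ n₀ +ℕ 1) 1)
    rowWeight-last = trans (rowWeight-shape m ≤-refl refl (⟦<⟧-irrefl m₀))
      (∙-weightOf w₂₂ (∙-weightOf (Σ<-weightOf n₀ (census 0 0 2 0) (λ _ _ → ∙-weightOf w₂₃ w₃₂)) (∙-weightOf w₂₃ w₃₁)))

    rungWeight-census : ∀ x → x < m → rungWeight x ≈ weightOf (census n₀ 0 2 0)
    rungWeight-census x x<m = trans (rungWeight-shape x x<m)
      (trans (∙-weightOf w₃₂ (∙-weightOf (Σ<-weightOf n₀ (census 1 0 0 0) (λ _ _ → w₃₃)) w₂₃))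
             (reflexive (cong (λ a → weightOf (census a 0 2 0)) (arith n₀))))
      where
      arith : ∀ k → 1 *ℕ k +ℕ 0 ≡ k
      arith = solve-∀

    rowsCensus rungsCensus : EdgeCensus
    rowsCensus = census 0 1 (2 *ℕ n₀ +ℕ 1) 1 ⊕ (m₀ ⊛ census (2 *ℕ n₀ +ℕ 1) 0 2 0 ⊕ census 0 1 (2 *ℕ n₀ +ℕ 1) 1)
    rungsCensus = m ⊛ census n₀ 0 2 0

    rowWeights-census : Σ< (suc m) rowWeight ≈ weightOf rowsCensus
    rowWeights-census = trans (∙-congˡ (Σ<-last m₀ (rowWeight ∘ suc)))
      (∙-weightOf rowWeight-first
        (∙-weightOf (Σ<-weightOf m₀ (census (2 *ℕ n₀ +ℕ 1) 0 2 0) rowWeight-inner) rowWeight-last))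

    rungWeights-census : Σ< m rungWeight ≈ weightOf rungsCensus
    rungWeights-census = Σ<-weightOf m (census n₀ 0 2 0) rungWeight-census

    HfEdges-weightSum : sumOf (edgeWeight E) E ≈
      (3 *ℕ m₀ *ℕ n₀ +ℕ m₀ +ℕ n₀) × w 3 3 ∙ 2 × w 2 2 ∙ (4 *ℕ m₀ +ℕ 4 *ℕ n₀ +ℕ 4) × w 3 2 ∙ 2 × w 3 1
    HfEdges-weightSum = begin
      sumOf (edgeWeight E) E                       ≈⟨ HfEdges-rows-rungs ⟩
      Σ< (suc m) rowWeight ∙ Σ< m rungWeight       ≈⟨ ∙-cong rowWeights-census rungWeights-census ⟩
      weightOf rowsCensus ∙ weightOf rungsCensus   ≈⟨ weightOf-⊕ rowsCensus rungsCensus ⟩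
      weightOf (rowsCensus ⊕ rungsCensus)
        ≡⟨ cong weightOf (cong₂ (λ a c → census a 2 c 2) (count₃₃ m₀ n₀) (count₃₂ m₀ n₀)) ⟩
      weightOf (census (3 *ℕ m₀ *ℕ n₀ +ℕ m₀ +ℕ n₀) 2 (4 *ℕ m₀ +ℕ 4 *ℕ n₀ +ℕ 4) 2)
        ≈⟨ weightOf-census _ 2 _ 2 ⟩
      (3 *ℕ m₀ *ℕ n₀ +ℕ m₀ +ℕ n₀) × w 3 3 ∙ 2 × w 2 2 ∙ (4 *ℕ m₀ +ℕ 4 *ℕ n₀ +ℕ 4) × w 3 2 ∙ 2 × w 3 1 ∎
      where
      count₃₃ : ∀ a b → (2 *ℕ b +ℕ 1) *ℕ a +ℕ 0 +ℕ b *ℕ suc a ≡ 3 *ℕ a *ℕ b +ℕ a +ℕ b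
      count₃₃ = solve-∀
      count₃₂ : ∀ a b → 2 *ℕ b +ℕ 1 +ℕ (2 *ℕ a +ℕ (2 *ℕ b +ℕ 1)) +ℕ 2 *ℕ suc a ≡ 4 *ℕ a +ℕ 4 *ℕ b +ℕ 4
      count₃₂ = solve-∀

module ZagrebWeight {c ℓ} (R : CommutativeSemiring c ℓ) (pa pb : ℕ → CommutativeSemiring.Carrier R) where

  open CommutativeSemiring R hiding (refl)
  open Zagreb R
  open import Algebra.Properties.CommutativeMonoid.Mult +-commutativeMonoid using (_×_; ×-congʳ; ×-assocˡ)
  open import Relation.Binary.Reasoning.Setoid setoid

  zagrebWeight : ℕ → ℕ → Carrier
  zagrebWeight a b = pa a * pb b + pb a * pa b

  zagrebWeight-sym : ∀ a b → zagrebWeight a b ≈ zagrebWeight b a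
  zagrebWeight-sym a b = trans (+-comm _ _) (+-cong (*-comm _ _) (*-comm _ _))

  zagrebWeight-diag : ∀ d → zagrebWeight d d ≈ 2 × (pa d * pb d)
  zagrebWeight-diag d = +-congˡ (trans (*-comm _ _) (sym (+-identityʳ _)))

  zagrebWeight-pendant : pa 1 ≈ 1# → pb 1 ≈ 1# → ∀ d → zagrebWeight d 1 ≈ pa d + pb d
  zagrebWeight-pendant pa1 pb1 d = +-cong (trans (*-congˡ pb1) (*-identityʳ _)) (trans (*-congˡ pa1) (*-identityʳ _))

  ·≡× : ∀ k x → k · x ≡ k × x
  ·≡× zero x = refl
  ·≡× (suc k) x = cong (x +_) (·≡× k x)

  zagrebWeight-types : pa 1 ≈ 1# → pb 1 ≈ 1# → ∀ a c →
    a × zagrebWeight 3 3 + 2 × zagrebWeight 2 2 + c × zagrebWeight 3 2 + 2 × zagrebWeight 3 1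
    ≈ a · (2 · (pa 3 * pb 3)) + 4 · (pa 2 * pb 2) + c · (pa 3 * pb 2 + pb 3 * pa 2) + 2 · (pa 3 + pb 3)
  zagrebWeight-types pa1 pb1 a c = begin
    a × zagrebWeight 3 3 + 2 × zagrebWeight 2 2 + c × zagrebWeight 3 2 + 2 × zagrebWeight 3 1
      ≈⟨ +-cong (+-congʳ (+-cong (×-congʳ a (zagrebWeight-diag 3))
                                 (trans (×-congʳ 2 (zagrebWeight-diag 2)) (×-assocˡ _ 2 2))))
                (×-congʳ 2 (zagrebWeight-pendant pa1 pb1 3)) ⟩
    a × (2 × (pa 3 * pb 3)) + 4 × (pa 2 * pb 2) + c × (pa 3 * pb 2 + pb 3 * pa 2) + 2 × (pa 3 + pb 3)
      ≡⟨ cong₂ (λ x y → x + 4 × (pa 2 * pb 2) + y + 2 × (pa 3 + pb 3))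
               (≡.sym (·≡× a (2 · (pa 3 * pb 3)))) (≡.sym (·≡× c (pa 3 * pb 2 + pb 3 * pa 2))) ⟩
    a · (2 · (pa 3 * pb 3)) + 4 · (pa 2 * pb 2) + c · (pa 3 * pb 2 + pb 3 * pa 2) + 2 · (pa 3 + pb 3) ∎

theorem1 : ∀ {c ℓ : Level} (R : CommutativeSemiring c ℓ) →
    let open CommutativeSemiring R
        open Zagreb R
    in (pa pb : ℕ → Carrier) → pa 1 ≈ 1# → pb 1 ≈ 1# →
       (m n : ℕ) → m ≥ 1 → n ≥ 1 →
       Z pa pb (HfEdges m n) ≈
         ((((3 *ℕ m *ℕ n +ℕ 1) ∸ (2 *ℕ m +ℕ 2 *ℕ n)) · (2 · (pa 3 * pb 3)))
         + (4 · (pa 2 * pb 2)))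
         + (((4 *ℕ m +ℕ 4 *ℕ n) ∸ 4) · ((pa 3 * pb 2) + (pb 3 * pa 2)))
         + (2 · (pa 3 + pb 3))
theorem1 R pa pb pa1 pb1 (suc m₀) (suc n₀) (s≤s z≤n) (s≤s z≤n) = begin
  Z pa pb (HfEdges (suc m₀) (suc n₀))
    ≈⟨ HfEdges-weightSum m₀ n₀ ⟩
  N₃₃ × zagrebWeight 3 3 + 2 × zagrebWeight 2 2 + N₃₂ × zagrebWeight 3 2 + 2 × zagrebWeight 3 1
    ≈⟨ zagrebWeight-types pa1 pb1 N₃₃ N₃₂ ⟩
  N₃₃ · (2 · (pa 3 * pb 3)) + 4 · (pa 2 * pb 2) + N₃₂ · (pa 3 * pb 2 + pb 3 * pa 2) + 2 · (pa 3 + pb 3)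
    ≡⟨ cong₂ (λ a c → a · (2 · (pa 3 * pb 3)) + 4 · (pa 2 * pb 2) + c · (pa 3 * pb 2 + pb 3 * pa 2) + 2 · (pa 3 + pb 3))
             (≡.sym N₃₃-paper) (≡.sym N₃₂-paper) ⟩
  _ ∎
  where
  open CommutativeSemiring R
  open Zagreb R
  open ZagrebWeight R pa pb
  open EdgeWeightSum +-commutativeMonoid zagrebWeight zagrebWeight-sym using (HfEdges-weightSum)
  open import Algebra.Properties.CommutativeMonoid.Mult +-commutativeMonoid using (_×_)
  open import Relation.Binary.Reasoning.Setoid setoid

  N₃₃ N₃₂ : ℕ
  N₃₃ = 3 *ℕ m₀ *ℕ n₀ +ℕ m₀ +ℕ n₀
  N₃₂ = 4 *ℕ m₀ +ℕ 4 *ℕ n₀ +ℕ 4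

  N₃₃-paper : (3 *ℕ suc m₀ *ℕ suc n₀ +ℕ 1) ∸ (2 *ℕ suc m₀ +ℕ 2 *ℕ suc n₀) ≡ N₃₃
  N₃₃-paper = ≡.trans (cong (_∸ (2 *ℕ suc m₀ +ℕ 2 *ℕ suc n₀)) (split m₀ n₀)) (m+n∸m≡n (2 *ℕ suc m₀ +ℕ 2 *ℕ suc n₀) N₃₃)
    where
    split : ∀ a b → 3 *ℕ suc a *ℕ suc b +ℕ 1 ≡ (2 *ℕ suc a +ℕ 2 *ℕ suc b) +ℕ (3 *ℕ a *ℕ b +ℕ a +ℕ b)
    split = solve-∀

  N₃₂-paper : (4 *ℕ suc m₀ +ℕ 4 *ℕ suc n₀) ∸ 4 ≡ N₃₂
  N₃₂-paper = ≡.trans (cong (_∸ 4) (split m₀ n₀)) (m+n∸m≡n 4 N₃₂)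
    where
    split : ∀ a b → 4 *ℕ suc a +ℕ 4 *ℕ suc b ≡ 4 +ℕ (4 *ℕ a +ℕ 4 *ℕ b +ℕ 4)
    split = solve-∀
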